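{- Let $m=2^k$ with $k\in\mathbb{N}$, $k\geq1$. Then there exists an odd integer $a$ with $1\leq a<m$ such that $K_{\mathbb{C}}(a/m)\leq 8$.
   Context: For $z\in\mathbb{C}$, $[z]:=\lfloor \mathrm{Re}(z)+\tfrac12\rfloor+i\lfloor \mathrm{Im}(z)+\tfrac12\rfloor$. Let $\mathfrak{F}=\{z\in\mathbb{C}: -\tfrac12\leq\mathrm{Re}(z)<\tfrac12,\ -\tfrac12\leq\mathrm{Im}(z)<\tfrac12\}$ and $T:\mathfrak{F}\to\mathfrak{F}$, $T(z)=z^{ -1}-[z^{ -1}]$ for $z\neq0$, $T(0)=0$. For $z\in\mathfrak{F}\setminus\{0\}$, $a_1(z)=[z^{ -1}]$ and, while $T^{n-1}(z)\neq0$, $a_n(z)=a_1(T^{n-1}(z))$. For general $z\in\mathbb{C}$, $a_0(z)=[z]$ and $a_n(z)=a_n(z-a_0(z))$ for $n\geq1$. For $z\in\mathbb{Q}(i)$ the sequence terminates, giving the Hurwitz continued fraction $[a_0(z);a_1(z),\ldots,a_n(z)]_{\mathbb{C}}$, and $K_{\mathbb{C}}(z):=\max(|a_1(z)|,\ldots,|a_n(z)|)$ (the term $a_0$ is not included). -}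

module Defs where

open import Data.Nat using (ℕ; zero; suc)
open import Data.Integer as ℤ using (ℤ)
open import Data.Rational using (ℚ; 0ℚ; ½; floor; _+_; _-_; _*_; -_; 1/_; ≢-nonZero)
open import Data.Rational using (_≟_)
import Data.Rational as ℚ
open import Data.Product using (_×_; _,_)
open import Data.List using (List; []; _∷_)
open import Data.Maybe using (Maybe; just; nothing; map)
open import Relation.Nullary using (yes; no)

record ℚ[i] : Set where
  constructor _+i_
  field
    re : ℚ
    im : ℚ
open ℚ[i] public

ℤ[i] : Set
ℤ[i] = ℤ × ℤ

embed : ℤ[i] → ℚ[i]
embed (x , y) = (x ℚ./ 1) +i (y ℚ./ 1)

_-ᶜ_ : ℚ[i] → ℚ[i] → ℚ[i]
(a +i b) -ᶜ (c +i d) = (a - c) +i (b - d)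

roundHalf : ℚ → ℤ
roundHalf x = floor (x + ½)

⟦_⟧ : ℚ[i] → ℤ[i]
⟦ z ⟧ = roundHalf (re z) , roundHalf (im z)

-- multiplicative inverse of a nonzero rational (value at 0 irrelevant)
invℚ : ℚ → ℚ
invℚ N with N ≟ 0ℚ
... | yes _ = 0ℚ
... | no ne = 1/_ N {{≢-nonZero ne}}

inv : ℚ[i] → ℚ[i]
inv (a +i b) = (a * invℚ (a * a + b * b)) +i ((- b) * invℚ (a * a + b * b))

-- Hurwitz digits a_1, a_2, … of w ∈ 𝔉, iterating T(w) = w⁻¹ - [w⁻¹]
-- with at most `fuel` steps; `nothing` if T^n(w) ≠ 0 for all n ≤ fuel.
digitsF : ℕ → ℚ[i] → Maybe (List ℤ[i])
digitsF fuel (a +i b) with a ≟ 0ℚ | b ≟ 0ℚ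
... | yes _ | yes _ = just []
digitsF zero _ | _ | _ = nothing
digitsF (suc fuel) w | _ | _ =
  let a₁ = ⟦ inv w ⟧ in map (a₁ ∷_) (digitsF fuel (inv w -ᶜ embed a₁))

-- Digits a_1(z), …, a_n(z) of a general z ∈ ℚ(i) (a_0 = [z] excluded),
-- computed within `fuel` steps of T.
hurwitzDigits : ℕ → ℚ[i] → Maybe (List ℤ[i])
hurwitzDigits fuel z = digitsF fuel (z -ᶜ embed ⟦ z ⟧)

normℤ[i] : ℤ[i] → ℤ
normℤ[i] (x , y) = x ℤ.* x ℤ.+ y ℤ.* y

realℚ : ℚ → ℚ[i]
realℚ q = q +i 0ℚ

-- For a real rational the Hurwitz algorithm is the nearest-integer continued fraction algorithm,
-- so it suffices to find an odd a < 2^k for which the expansion of 2^k/a has all partial quotients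
-- at most 8 (digits of norm at most 64). Such a come in pairs: if a/N and b/N have bounded
-- expansions and ab ≡ ±1 (mod N), then for P = xN with 4 ≤ x ≤ 8 the expansion of (Pa ± 1)/(PN)
-- is that of a/N followed by x and that of b/N ("folding"), and (Pa + 1)(Pa − 1) ≡ −1 (mod PN)
-- makes these two a new pair. Starting from N = 4, 8, 16, 32 and folding with x = 4 or 8 reaches
-- every power of 2.
module Submission where

open import Defs
open import Data.Nat using (ℕ; _≤_; _<_; _^_; _%_)
open import Data.Nat.Properties using (m^n≢0)
open import Data.Integer using (+_) renaming (_≤_ to _≤ℤ_)
open import Data.Rational using (_/_)
open import Data.Product using (Σ; _×_; ∃)
open import Data.List using (List)
open import Data.List.Relation.Unary.All using (All)
open import Data.Maybe using (just)
open import Relation.Binary.PropositionalEquality using (_≡_)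

open import Data.Nat as ℕ using (zero; suc; z≤n; s≤s)
import Data.Nat.Properties as ℕP
import Data.Nat.Divisibility as ℕᵈ
open import Data.Nat.DivMod using ([m+kn]%n≡m%n; m≡m%n+[m/n]*n; m%n<n; m/n≤m) renaming (_/_ to _div_)
open import Data.Nat.Induction using (<-rec)
import Data.Nat.Tactic.RingSolver as ℕSolver
open import Data.Integer as ℤ using (ℤ; +[1+_]; -[1+_]; ∣_∣; 0ℤ; 1ℤ; -1ℤ)
import Data.Integer.Properties as ℤP
open import Data.Integer.DivMod using ([n/d]*d≤n; a≡a%n+[a/n]*n; n%d<d)
open import Data.Integer.Divisibility.Signed using (_∣_; divides; ∣-refl; ∣m∣n⇒∣m+n; ∣m∣n⇒∣m-n; ∣n⇒∣m*n; ∣⇒∣ᵤ)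
open import Data.Integer.Tactic.RingSolver using (solve-∀; solve)
open import Data.Rational as ℚ using (ℚ; mkℚ; 0ℚ; 1ℚ; ½; floor)
import Data.Rational.Properties as ℚP
open import Data.Rational.Unnormalised as ℚᵘ using (mkℚᵘ; *≡*; _≃_)
import Data.Rational.Unnormalised.Properties as ℚᵘP
open import Data.List using ([]; _∷_)
import Data.List.Relation.Unary.All as All
open import Data.Maybe using (map)
open import Data.Product using (_,_; proj₁; proj₂)
open import Data.Bool using (T)
open import Data.Empty using (⊥-elim)
open import Relation.Nullary using (yes; no)
open import Relation.Binary.PropositionalEquality

data Unit : ℤ → Set where
  1ᵘ  : Unit 1ℤ
  -1ᵘ : Unit -1ℤ

unit-* : ∀ {σ τ} → Unit σ → Unit τ → Unit (σ ℤ.* τ)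
unit-* 1ᵘ  1ᵘ  = 1ᵘ
unit-* 1ᵘ  -1ᵘ = -1ᵘ
unit-* -1ᵘ 1ᵘ  = -1ᵘ
unit-* -1ᵘ -1ᵘ = 1ᵘ

unit-neg : ∀ {σ} → Unit σ → Unit (ℤ.- σ)
unit-neg 1ᵘ  = -1ᵘ
unit-neg -1ᵘ = 1ᵘ

∣unit∣≡1 : ∀ {σ} → Unit σ → ∣ σ ∣ ≡ 1
∣unit∣≡1 1ᵘ  = refl
∣unit∣≡1 -1ᵘ = refl

∣unit*i∣≡∣i∣ : ∀ {σ} → Unit σ → ∀ i → ∣ σ ℤ.* i ∣ ≡ ∣ i ∣
∣unit*i∣≡∣i∣ 1ᵘ  i = cong ∣_∣ (ℤP.*-identityˡ i)
∣unit*i∣≡∣i∣ -1ᵘ i = trans (cong ∣_∣ (ℤP.-1*i≡-i i)) (ℤP.∣-i∣≡∣i∣ i)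

*-unit-unit : ∀ {σ} → Unit σ → ∀ a b → σ ℤ.* a ℤ.* (σ ℤ.* b) ≡ a ℤ.* b
*-unit-unit 1ᵘ  a b = solve (a ∷ b ∷ [])
*-unit-unit -1ᵘ a b = solve (a ∷ b ∷ [])

unit-conjugate : ∀ {σ} → Unit σ → ∀ A → A ℤ.- σ ℤ.* A ℤ.* σ ≡ 0ℤ
unit-conjugate 1ᵘ  A = solve (A ∷ [])
unit-conjugate -1ᵘ A = solve (A ∷ [])

∣i∣≡n⇒i≡unit*n : ∀ {i n} → ∣ i ∣ ≡ n → Σ ℤ λ κ → Unit κ × i ≡ κ ℤ.* + n
∣i∣≡n⇒i≡unit*n {+ n}      refl = 1ℤ , 1ᵘ , sym (ℤP.*-identityˡ (+ n))
∣i∣≡n⇒i≡unit*n { -[1+ n ]} refl = -1ℤ , -1ᵘ , sym (ℤP.-1*i≡-i (+ suc n))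

∣∣-bounds : ∀ i {k} → ∣ i ∣ ≤ k → ℤ.- (+ k) ℤ.≤ i × i ℤ.≤ + k
∣∣-bounds (+ n)    ∣i∣≤k = ℤP.neg-≤-pos , ℤ.+≤+ ∣i∣≤k
∣∣-bounds -[1+ n ] ∣i∣≤k = ℤP.neg-mono-≤ (ℤ.+≤+ ∣i∣≤k) , ℤ.-≤+

a+n<b⇒a<b-n : ∀ {a b n} → a ℕ.+ n < b → + a ℤ.< + b ℤ.- + n
a+n<b⇒a<b-n {a} {b} {n} a+n<b =
  subst (ℤ._< + b ℤ.- + n) (trans (cong (ℤ._- + n) (ℤP.pos-+ a n)) (cancel (+ a) (+ n)))
    (ℤP.+-monoˡ-< (ℤ.- + n) (ℤ.+<+ a+n<b))
  where
  cancel : ∀ a b → a ℤ.+ b ℤ.- b ≡ a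
  cancel = solve-∀

∣-small⇒0 : ∀ {N i} → + N ∣ i → ∣ i ∣ < N → i ≡ 0ℤ
∣-small⇒0 {N} {i} N∣i ∣i∣<N with ∣ i ∣ in ∣i∣≡
... | zero  = ℤP.∣i∣≡0⇒i≡0 ∣i∣≡
... | suc _ = ⊥-elim (ℕᵈ.>⇒∤ ∣i∣<N (subst (N ℕᵈ.∣_) ∣i∣≡ (∣⇒∣ᵤ N∣i)))

odd⇒positive : ∀ {n} → n % 2 ≡ 1 → 1 ≤ n
odd⇒positive {suc n} _ = s≤s z≤n

even+1-odd : ∀ {n} → 2 ℕᵈ.∣ n → (n ℕ.+ 1) % 2 ≡ 1
even+1-odd (ℕᵈ.divides k refl) = trans (cong (_% 2) (ℕP.+-comm (k ℕ.* 2) 1)) ([m+kn]%n≡m%n 1 k 2)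

≤! : ∀ {m n} {_ : T (m ℕ.≤ᵇ n)} → m ≤ n
≤! {m} {n} {m≤ᵇn} = ℕP.≤ᵇ⇒≤ m n m≤ᵇn

/-unique : ∀ n d m → d ℤ.* +[1+ m ] ℤ.≤ n → n ℤ.< (1ℤ ℤ.+ d) ℤ.* +[1+ m ] →
           n ℤ./ +[1+ m ] ≡ d
/-unique n d m dM≤n n<[1+d]M = ℤP.≤-antisym (<1+⇒≤ q<1+d) (<1+⇒≤ d<1+q)
  where
  M : ℤ
  M = +[1+ m ]
  q : ℤ
  q = n ℤ./ M
  n<[1+q]M : n ℤ.< (1ℤ ℤ.+ q) ℤ.* M
  n<[1+q]M = begin-strict
    n                        ≡⟨ a≡a%n+[a/n]*n n M ⟩
    + (n ℤ.% M) ℤ.+ q ℤ.* M  <⟨ ℤP.+-monoˡ-< (q ℤ.* M) (ℤ.+<+ (n%d<d n M)) ⟩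
    M ℤ.+ q ℤ.* M            ≡⟨ ℤP.suc-* q M ⟨
    (1ℤ ℤ.+ q) ℤ.* M         ∎
    where open ℤP.≤-Reasoning
  d<1+q : d ℤ.< 1ℤ ℤ.+ q
  d<1+q = ℤP.*-cancelʳ-<-nonNeg M (ℤP.≤-<-trans dM≤n n<[1+q]M)
  q<1+d : q ℤ.< 1ℤ ℤ.+ d
  q<1+d = ℤP.*-cancelʳ-<-nonNeg M (ℤP.≤-<-trans ([n/d]*d≤n n M) n<[1+d]M)
  <1+⇒≤ : ∀ {i j} → i ℤ.< 1ℤ ℤ.+ j → i ℤ.≤ j
  <1+⇒≤ {i} {j} i<1+j = subst (i ℤ.≤_) (ℤP.pred-suc j) (ℤP.i<j⇒i≤pred[j] i<1+j)

floor-unique : ∀ {w n m} d → ℚ.toℚᵘ w ≃ mkℚᵘ n m →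
               d ℤ.* +[1+ m ] ℤ.≤ n → n ℤ.< (1ℤ ℤ.+ d) ℤ.* +[1+ m ] → floor w ≡ d
floor-unique {mkℚ N e _} {n} {m} d (*≡* NM≡nE) dM≤n n<[1+d]M =
  /-unique N d e
    (ℤP.*-cancelʳ-≤-pos (d ℤ.* E) N M
      (subst₂ ℤ._≤_ (swap d M E) (sym NM≡nE) (ℤP.*-monoʳ-≤-nonNeg E dM≤n)))
    (ℤP.*-cancelʳ-<-nonNeg M
      (subst₂ ℤ._<_ (sym NM≡nE) (swap (1ℤ ℤ.+ d) M E) (ℤP.*-monoʳ-<-pos E n<[1+d]M)))
  where
  M : ℤ
  M = +[1+ m ]
  E : ℤ
  E = +[1+ e ]
  swap : ∀ a b c → a ℤ.* b ℤ.* c ≡ a ℤ.* c ℤ.* b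
  swap = solve-∀

roundHalf-nearest : ∀ {y n m} d → ℚ.toℚᵘ y ≃ mkℚᵘ n m →
                    2 ℕ.* ∣ n ℤ.- d ℤ.* +[1+ m ] ∣ < suc m → roundHalf y ≡ d
roundHalf-nearest {y} {n} {m} d y≃n/M 2∣e∣<M = floor-unique d y+½≃ lower upper
  where
  open ℤP.≤-Reasoning
  M : ℤ
  M = +[1+ m ]
  e : ℤ
  e = n ℤ.- d ℤ.* M
  y+½≃ : ℚ.toℚᵘ (y ℚ.+ ½) ≃ mkℚᵘ n m ℚᵘ.+ mkℚᵘ (+ 1) 1
  y+½≃ = ℚᵘP.≃-trans (ℚP.toℚᵘ-homo-+ y ½) (ℚᵘP.+-congˡ (mkℚᵘ (+ 1) 1) y≃n/M)
  2e-bounds : ℤ.- + (2 ℕ.* ∣ e ∣) ℤ.≤ + 2 ℤ.* e × + 2 ℤ.* e ℤ.≤ + (2 ℕ.* ∣ e ∣)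
  2e-bounds = ∣∣-bounds (+ 2 ℤ.* e) (ℕP.≤-reflexive (ℤP.∣i*j∣≡∣i∣*∣j∣ (+ 2) e))
  -M<2e : ℤ.- M ℤ.< + 2 ℤ.* e
  -M<2e = ℤP.<-≤-trans (ℤP.neg-mono-< (ℤ.+<+ 2∣e∣<M)) (proj₁ 2e-bounds)
  2e<M : + 2 ℤ.* e ℤ.< M
  2e<M = ℤP.≤-<-trans (proj₂ 2e-bounds) (ℤ.+<+ 2∣e∣<M)
  around : ∀ n d M → n ℤ.* + 2 ℤ.+ + 1 ℤ.* M ≡ d ℤ.* (M ℤ.* + 2) ℤ.+ M ℤ.+ + 2 ℤ.* (n ℤ.- d ℤ.* M)
  around = solve-∀
  cancel : ∀ a M → a ≡ a ℤ.+ M ℤ.+ ℤ.- M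
  cancel = solve-∀
  next : ∀ d M → d ℤ.* (M ℤ.* + 2) ℤ.+ M ℤ.+ M ≡ (1ℤ ℤ.+ d) ℤ.* (M ℤ.* + 2)
  next = solve-∀
  lower : d ℤ.* (M ℤ.* + 2) ℤ.≤ n ℤ.* + 2 ℤ.+ + 1 ℤ.* M
  lower = begin
    d ℤ.* (M ℤ.* + 2)                   ≡⟨ cancel (d ℤ.* (M ℤ.* + 2)) M ⟩
    d ℤ.* (M ℤ.* + 2) ℤ.+ M ℤ.+ ℤ.- M     ≤⟨ ℤP.+-monoʳ-≤ (d ℤ.* (M ℤ.* + 2) ℤ.+ M) (ℤP.<⇒≤ -M<2e) ⟩
    d ℤ.* (M ℤ.* + 2) ℤ.+ M ℤ.+ + 2 ℤ.* e ≡⟨ around n d M ⟨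
    n ℤ.* + 2 ℤ.+ + 1 ℤ.* M             ∎
  upper : n ℤ.* + 2 ℤ.+ + 1 ℤ.* M ℤ.< (1ℤ ℤ.+ d) ℤ.* (M ℤ.* + 2)
  upper = begin-strict
    n ℤ.* + 2 ℤ.+ + 1 ℤ.* M             ≡⟨ around n d M ⟩
    d ℤ.* (M ℤ.* + 2) ℤ.+ M ℤ.+ + 2 ℤ.* e <⟨ ℤP.+-monoʳ-< (d ℤ.* (M ℤ.* + 2) ℤ.+ M) 2e<M ⟩
    d ℤ.* (M ℤ.* + 2) ℤ.+ M ℤ.+ M         ≡⟨ next d M ⟩
    (1ℤ ℤ.+ d) ℤ.* (M ℤ.* + 2)          ∎

-- Hurwitz digits of real rationals

SmallDigit : ℤ[i] → Set
SmallDigit d = normℤ[i] d ℤ.≤ + 64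

SmallDigits : ℚ → Set
SmallDigits x = Σ ℕ λ fuel → Σ (List ℤ[i]) λ ds →
                digitsF fuel (x +i 0ℚ) ≡ just ds × All SmallDigit ds

recip : ℚ → ℚ
recip x = re (inv (x +i 0ℚ))

recip-inverse : ∀ {x} → x ≢ 0ℚ → recip x ℚ.* x ≡ 1ℚ
recip-inverse {x} x≢0 with x ℚ.* x ℚ.+ 0ℚ ℚ.* 0ℚ ℚ.≟ 0ℚ | ℚP.+-identityʳ (x ℚ.* x)
... | yes N≡0 | N≡x² = ⊥-elim (x≢0 (begin
  x                     ≡⟨ ℚP.*-identityʳ x ⟨
  x ℚ.* 1ℚ              ≡⟨ cong (x ℚ.*_) (ℚP.*-inverseʳ x) ⟨
  x ℚ.* (x ℚ.* ℚ.1/ x)  ≡⟨ ℚP.*-assoc x x _ ⟨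
  x ℚ.* x ℚ.* ℚ.1/ x    ≡⟨ cong (ℚ._* ℚ.1/ x) (trans (sym N≡x²) N≡0) ⟩
  0ℚ ℚ.* ℚ.1/ x         ≡⟨ ℚP.*-zeroˡ (ℚ.1/ x) ⟩
  0ℚ                    ∎))
  where
  open ≡-Reasoning
  instance _ = ℚ.≢-nonZero x≢0
... | no N≢0 | N≡x² = begin
  x ℚ.* ℚ.1/ N ℚ.* x    ≡⟨ ℚP.*-assoc x _ x ⟩
  x ℚ.* (ℚ.1/ N ℚ.* x)  ≡⟨ cong (x ℚ.*_) (ℚP.*-comm _ x) ⟩
  x ℚ.* (x ℚ.* ℚ.1/ N)  ≡⟨ ℚP.*-assoc x x _ ⟨
  x ℚ.* x ℚ.* ℚ.1/ N    ≡⟨ cong (ℚ._* ℚ.1/ N) N≡x² ⟨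
  N ℚ.* ℚ.1/ N          ≡⟨ ℚP.*-inverseʳ N ⟩
  1ℚ                    ∎
  where
  open ≡-Reasoning
  N : ℚ
  N = x ℚ.* x ℚ.+ 0ℚ ℚ.* 0ℚ
  instance _ = ℚ.≢-nonZero N≢0

inverse-≃ : ∀ {x y p m n k} → y ℚ.* x ≡ 1ℚ → ℚ.toℚᵘ x ≃ mkℚᵘ p m →
            mkℚᵘ p m ℚᵘ.* mkℚᵘ n k ≃ ℚᵘ.1ℚᵘ → ℚ.toℚᵘ y ≃ mkℚᵘ n k
inverse-≃ {x} {y} {p} {m} {n} {k} yx≡1 x≃p/m pn≃1 = begin
  Y                             ≈⟨ ℚᵘP.*-identityʳ Y ⟨
  Y ℚᵘ.* ℚᵘ.1ℚᵘ                  ≈⟨ ℚᵘP.*-congˡ {Y} pn≃1 ⟨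
  Y ℚᵘ.* (mkℚᵘ p m ℚᵘ.* Z)        ≈⟨ ℚᵘP.*-congˡ {Y} (ℚᵘP.*-congʳ {Z} x≃p/m) ⟨
  Y ℚᵘ.* (ℚ.toℚᵘ x ℚᵘ.* Z)        ≈⟨ ℚᵘP.*-assoc Y _ Z ⟨
  Y ℚᵘ.* ℚ.toℚᵘ x ℚᵘ.* Z          ≈⟨ ℚᵘP.*-congʳ {Z} (ℚP.toℚᵘ-homo-* y x) ⟨
  ℚ.toℚᵘ (y ℚ.* x) ℚᵘ.* Z        ≈⟨ ℚᵘP.*-congʳ {Z} (ℚᵘP.≃-reflexive (cong ℚ.toℚᵘ yx≡1)) ⟩
  ℚᵘ.1ℚᵘ ℚᵘ.* Z                  ≈⟨ ℚᵘP.*-identityˡ Z ⟩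
  Z                             ∎
  where
  open ℚᵘP.≃-Reasoning
  Y : ℚᵘ.ℚᵘ
  Y = ℚ.toℚᵘ y
  Z : ℚᵘ.ℚᵘ
  Z = mkℚᵘ n k

≃-nonzero : ∀ {x p m} → ℚ.toℚᵘ x ≃ mkℚᵘ p m → p ≢ 0ℤ → x ≢ 0ℚ
≃-nonzero x≃p/m p≢0 refl = p≢0 (trans (sym (ℤP.*-identityʳ _)) (sym (ℚᵘP.drop-*≡* x≃p/m)))

≃-zero : ∀ {x m} → ℚ.toℚᵘ x ≃ mkℚᵘ 0ℤ m → x ≡ 0ℚ
≃-zero x≃0 = ℚP.toℚᵘ-injective (ℚᵘP.≃-trans x≃0 (*≡* refl))

digitsF-real : ∀ f {x} → x ≢ 0ℚ →
  digitsF (suc f) (x +i 0ℚ) ≡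
  map ((roundHalf (recip x) , 0ℤ) ∷_) (digitsF f ((recip x ℚ.- roundHalf (recip x) ℚ./ 1) +i 0ℚ))
digitsF-real f {x} x≢0 with x ℚ.≟ 0ℚ
... | yes x≡0 = ⊥-elim (x≢0 x≡0)
... | no _ rewrite ℚP.*-zeroˡ (invℚ (x ℚ.* x ℚ.+ 0ℚ ℚ.* 0ℚ)) = refl

smallDigits-step : ∀ {x d} → x ≢ 0ℚ → roundHalf (recip x) ≡ d → SmallDigit (d , 0ℤ) →
                   SmallDigits (recip x ℚ.- d ℚ./ 1) → SmallDigits x
smallDigits-step x≢0 refl small (f , ds , eq , all) =
  suc f , _ ∷ ds , trans (digitsF-real f x≢0) (cong (map _) eq) , small All.∷ all

smallDigit-unit : ∀ {σ D} → Unit σ → D ≤ 8 → SmallDigit (σ ℤ.* + D , 0ℤ)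
smallDigit-unit {σ} {D} unit D≤8 = begin
  σ ℤ.* + D ℤ.* (σ ℤ.* + D) ℤ.+ 0ℤ  ≡⟨ ℤP.+-identityʳ _ ⟩
  σ ℤ.* + D ℤ.* (σ ℤ.* + D)         ≡⟨ *-unit-unit unit (+ D) (+ D) ⟩
  + D ℤ.* + D                     ≡⟨ ℤP.pos-* D D ⟨
  + (D ℕ.* D)                     ≤⟨ ℤ.+≤+ (ℕP.*-mono-≤ D≤8 D≤8) ⟩
  + 64                            ∎
  where open ℤP.≤-Reasoning

-- NICF q r: the nearest-integer continued fraction q/r = D₁ + τ₁/(D₂ + τ₂/(⋯ + τₙ/Dₙ)), τᵢ = ±1,
-- has all partial quotients in [2, 8]; 2s < r says that D is the integer nearest to q/r.
data NICF : ℕ → ℕ → Set where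
  end  : NICF 1 0
  step : ∀ {q r s τ} (D : ℕ) → Unit τ → + q ≡ + D ℤ.* + r ℤ.+ τ ℤ.* + s →
         2 ℕ.* s < r → 2 ≤ D → D ≤ 8 → NICF r s → NICF q r

-- 1/(σr/q) = σD + στs/r with 2s < r, so the first Hurwitz digit of σr/q is σD and T(σr/q) = στs/r.
nicf⇒smallDigits : ∀ {m r σ x} → NICF (suc m) r → Unit σ →
                   ℚ.toℚᵘ x ≃ mkℚᵘ (σ ℤ.* + r) m → SmallDigits x
nicf⇒smallDigits {σ = σ} {x} end _ x≃σ0 = 0 , [] , digits-of-0 , All.[]
  where
  digits-of-0 : digitsF 0 (x +i 0ℚ) ≡ just []
  digits-of-0 rewrite ≃-zero (subst (λ n → ℚ.toℚᵘ x ≃ mkℚᵘ n 0) (ℤP.*-zeroʳ σ) x≃σ0) = refl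
nicf⇒smallDigits {r = zero} (step _ _ _ () _ _ _) _ _
nicf⇒smallDigits {m} {suc k} {σ} {x} (step {s = s} {τ} D τ-unit q≡Dr+τs 2s<r _ D≤8 tail) σ-unit x≃ =
  smallDigits-step x≢0 rounds-to-σD (smallDigit-unit σ-unit D≤8)
    (nicf⇒smallDigits tail (unit-* σ-unit τ-unit) remainder≃)
  where
  Q : ℤ
  Q = + suc m
  R : ℤ
  R = + suc k
  σD : ℤ
  σD = σ ℤ.* + D
  x≢0 : x ≢ 0ℚ
  x≢0 = ≃-nonzero x≃ λ σR≡0 → ℕP.1+n≢0 (trans (sym (∣unit*i∣≡∣i∣ σ-unit R)) (cong ∣_∣ σR≡0))
  recip≃ : ℚ.toℚᵘ (recip x) ≃ mkℚᵘ (σ ℤ.* Q) k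
  recip≃ = inverse-≃ (recip-inverse x≢0) x≃ (*≡* (begin
    σ ℤ.* R ℤ.* (σ ℤ.* Q) ℤ.* + 1  ≡⟨ ℤP.*-identityʳ _ ⟩
    σ ℤ.* R ℤ.* (σ ℤ.* Q)         ≡⟨ *-unit-unit σ-unit R Q ⟩
    R ℤ.* Q                      ≡⟨ ℤP.*-comm R Q ⟩
    Q ℤ.* R                      ≡⟨ ℤP.*-identityˡ _ ⟨
    + 1 ℤ.* (Q ℤ.* R)            ∎))
    where open ≡-Reasoning
  distance : ∀ σ D R τ s → σ ℤ.* (D ℤ.* R ℤ.+ τ ℤ.* s) ℤ.- σ ℤ.* D ℤ.* R ≡ σ ℤ.* τ ℤ.* s
  distance = solve-∀
  σQ-σDR≡στs : σ ℤ.* Q ℤ.- σ ℤ.* + D ℤ.* R ≡ σ ℤ.* τ ℤ.* + s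
  σQ-σDR≡στs = trans (cong (λ q → σ ℤ.* q ℤ.- σ ℤ.* + D ℤ.* R) q≡Dr+τs) (distance σ (+ D) R τ (+ s))
  rounds-to-σD : roundHalf (recip x) ≡ σD
  rounds-to-σD = roundHalf-nearest σD recip≃
    (subst (λ t → 2 ℕ.* t < suc k)
      (sym (trans (cong ∣_∣ σQ-σDR≡στs) (∣unit*i∣≡∣i∣ (unit-* σ-unit τ-unit) (+ s)))) 2s<r)
  remainder : ∀ σ D R τ s → (σ ℤ.* (D ℤ.* R ℤ.+ τ ℤ.* s) ℤ.* + 1 ℤ.+ ℤ.- (σ ℤ.* D) ℤ.* R) ℤ.* R
                          ≡ σ ℤ.* τ ℤ.* s ℤ.* (R ℤ.* + 1)
  remainder = solve-∀
  remainder≃ : ℚ.toℚᵘ (recip x ℚ.- σD ℚ./ 1) ≃ mkℚᵘ (σ ℤ.* τ ℤ.* + s) k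
  remainder≃ = ℚᵘP.≃-trans (ℚP.toℚᵘ-homo-+ (recip x) (ℚ.- (σD ℚ./ 1)))
    (ℚᵘP.≃-trans (ℚᵘP.+-cong recip≃ (ℚᵘP.≃-trans (ℚP.toℚᵘ-homo‿- (σD ℚ./ 1))
                                      (ℚᵘP.-‿cong (ℚP.toℚᵘ-fromℚᵘ (mkℚᵘ σD 0)))))
      (*≡* (subst (λ q → (σ ℤ.* q ℤ.* + 1 ℤ.+ ℤ.- σD ℤ.* R) ℤ.* R ≡ σ ℤ.* τ ℤ.* + s ℤ.* (R ℤ.* + 1))
                  (sym q≡Dr+τs) (remainder σ (+ D) R τ (+ s)))))

fraction-smallDigits : ∀ {m a} .{{_ : ℕ.NonZero m}} → NICF m a → 2 ℕ.* a < m →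
  Σ ℕ λ fuel → Σ (List ℤ[i]) λ ds →
    hurwitzDigits fuel (realℚ (+ a ℚ./ m)) ≡ just ds × All SmallDigit ds
fraction-smallDigits {suc m} {a} expansion 2a<m = integral-part-0 (nicf⇒smallDigits expansion 1ᵘ 1a/m≃)
  where
  x : ℚ
  x = + a ℚ./ suc m
  x≃ : ℚ.toℚᵘ x ≃ mkℚᵘ (+ a) m
  x≃ = ℚP.toℚᵘ-fromℚᵘ (mkℚᵘ (+ a) m)
  1a/m≃ : ℚ.toℚᵘ x ≃ mkℚᵘ (1ℤ ℤ.* + a) m
  1a/m≃ = subst (λ n → ℚ.toℚᵘ x ≃ mkℚᵘ n m) (sym (ℤP.*-identityˡ (+ a))) x≃
  rounds-to-0 : roundHalf x ≡ 0ℤ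
  rounds-to-0 = roundHalf-nearest 0ℤ x≃ (subst (λ t → 2 ℕ.* t < suc m) (sym (ℕP.+-identityʳ a)) 2a<m)
  fractional-part : realℚ x -ᶜ embed ⟦ realℚ x ⟧ ≡ x +i 0ℚ
  fractional-part rewrite rounds-to-0 = cong (_+i 0ℚ) (ℚP.+-identityʳ x)
  integral-part-0 : SmallDigits x → Σ ℕ λ fuel → Σ (List ℤ[i]) λ ds →
                      hurwitzDigits fuel (realℚ x) ≡ just ds × All SmallDigit ds
  integral-part-0 (fuel , ds , eq , all) = fuel , ds , trans (cong (digitsF fuel) fractional-part) eq , all

-- Folding

det-bound : ∀ q r U V → ∣ U ∣ ≤ ∣ V ∣ →
            q ℕ.* ∣ V ∣ ≤ ∣ + q ℤ.* V ℤ.- + r ℤ.* U ∣ ℕ.+ r ℕ.* ∣ V ∣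
det-bound q r U V ∣U∣≤∣V∣ = begin
  q ℕ.* ∣ V ∣                     ≡⟨ ℤP.∣i*j∣≡∣i∣*∣j∣ (+ q) V ⟨
  ∣ + q ℤ.* V ∣                   ≡⟨ cong ∣_∣ (split (+ q ℤ.* V) (+ r ℤ.* U)) ⟩
  ∣ Δ ℤ.+ + r ℤ.* U ∣              ≤⟨ ℤP.∣i+j∣≤∣i∣+∣j∣ Δ (+ r ℤ.* U) ⟩
  ∣ Δ ∣ ℕ.+ ∣ + r ℤ.* U ∣          ≡⟨ cong (∣ Δ ∣ ℕ.+_) (ℤP.∣i*j∣≡∣i∣*∣j∣ (+ r) U) ⟩
  ∣ Δ ∣ ℕ.+ r ℕ.* ∣ U ∣            ≤⟨ ℕP.+-monoʳ-≤ ∣ Δ ∣ (ℕP.*-monoʳ-≤ r ∣U∣≤∣V∣) ⟩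
  ∣ Δ ∣ ℕ.+ r ℕ.* ∣ V ∣            ∎
  where
  open ℕP.≤-Reasoning
  Δ : ℤ
  Δ = + q ℤ.* V ℤ.- + r ℤ.* U
  split : ∀ a b → a ≡ a ℤ.- b ℤ.+ b
  split = solve-∀

perturbation-bound : ∀ {q r N} k U V → k ℕ.+ r ≤ q → ∣ U ∣ ≤ ∣ V ∣ →
                     ∣ + q ℤ.* V ℤ.- + r ℤ.* U ∣ ≡ N → k ℕ.* ∣ V ∣ ≤ N
perturbation-bound {q} {r} {N} k U V k+r≤q ∣U∣≤∣V∣ det =
  ℕP.+-cancelʳ-≤ (r ℕ.* ∣ V ∣) (k ℕ.* ∣ V ∣) N (begin
    k ℕ.* ∣ V ∣ ℕ.+ r ℕ.* ∣ V ∣  ≡⟨ ℕP.*-distribʳ-+ ∣ V ∣ k r ⟨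
    (k ℕ.+ r) ℕ.* ∣ V ∣         ≤⟨ ℕP.*-monoˡ-≤ ∣ V ∣ k+r≤q ⟩
    q ℕ.* ∣ V ∣                 ≤⟨ det-bound q r U V ∣U∣≤∣V∣ ⟩
    _ ℕ.+ r ℕ.* ∣ V ∣            ≡⟨ cong (ℕ._+ r ℕ.* ∣ V ∣) det ⟩
    N ℕ.+ r ℕ.* ∣ V ∣            ∎)
  where open ℕP.≤-Reasoning

∣V∣≤∣U-DV∣ : ∀ U V D → ∣ U ∣ ≤ ∣ V ∣ → 2 ≤ D → ∣ V ∣ ≤ ∣ U ℤ.- + D ℤ.* V ∣
∣V∣≤∣U-DV∣ U V D ∣U∣≤∣V∣ 2≤D = ℕP.+-cancelˡ-≤ ∣ V ∣ _ _ (begin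
  ∣ V ∣ ℕ.+ ∣ V ∣                     ≡⟨ cong (∣ V ∣ ℕ.+_) (ℕP.+-identityʳ ∣ V ∣) ⟨
  2 ℕ.* ∣ V ∣                        ≤⟨ ℕP.*-monoˡ-≤ ∣ V ∣ 2≤D ⟩
  D ℕ.* ∣ V ∣                        ≡⟨ ℤP.∣i*j∣≡∣i∣*∣j∣ (+ D) V ⟨
  ∣ + D ℤ.* V ∣                      ≡⟨ cong ∣_∣ (difference U (+ D ℤ.* V)) ⟩
  ∣ U ℤ.- (U ℤ.- + D ℤ.* V) ∣          ≤⟨ ℤP.∣i-j∣≤∣i∣+∣j∣ U _ ⟩
  ∣ U ∣ ℕ.+ ∣ U ℤ.- + D ℤ.* V ∣        ≤⟨ ℕP.+-monoˡ-≤ _ ∣U∣≤∣V∣ ⟩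
  ∣ V ∣ ℕ.+ ∣ U ℤ.- + D ℤ.* V ∣        ∎)
  where
  open ℕP.≤-Reasoning
  difference : ∀ a b → b ≡ a ℤ.- (a ℤ.- b)
  difference = solve-∀

D*1+τ*0≡D : ∀ D τ → + D ℤ.* + 1 ℤ.+ τ ℤ.* + 0 ≡ + D
D*1+τ*0≡D D τ = trans (cong₂ ℤ._+_ (ℤP.*-identityʳ (+ D)) (ℤP.*-zeroʳ τ)) (ℤP.+-identityʳ (+ D))

step-ℤ : ∀ {Q R S τ} D → Unit τ → 0ℤ ℤ.≤ Q → 0ℤ ℤ.≤ R → 0ℤ ℤ.≤ S →
         Q ≡ + D ℤ.* R ℤ.+ τ ℤ.* S → + 2 ℤ.* S ℤ.< R → 2 ≤ D → D ≤ 8 →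
         NICF ∣ R ∣ ∣ S ∣ → NICF ∣ Q ∣ ∣ R ∣
step-ℤ {R = + r} {S = + s} D τ (ℤ.+≤+ _) (ℤ.+≤+ _) (ℤ.+≤+ _) Q≡ 2S<R =
  step D τ Q≡ (ℤP.drop‿+<+ (subst (ℤ._< + r) (sym (ℤP.pos-* 2 s)) 2S<R))

inverse-unique : ∀ {N a b δ ε} → Unit δ → Unit ε → + N ∣ + a ℤ.* + b ℤ.- δ → 2 ℕ.* b < N →
                 ∀ V → + N ∣ 1ℤ ℤ.- ε ℤ.* + a ℤ.* V → 2 ℕ.* ∣ V ∣ ≤ N → ∣ V ∣ ≡ b
inverse-unique {N} {a} {b} {δ} {ε} δ-unit ε-unit ab≡δ 2b<N V εaV≡1 2∣V∣≤N =
  trans (sym (∣unit*i∣≡∣i∣ (unit-* ε-unit δ-unit) V)) (cong ∣_∣ w≡b)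
  where
  w : ℤ
  w = ε ℤ.* δ ℤ.* V
  combination : ∀ A B δ ε V → B ℤ.- ε ℤ.* δ ℤ.* V
              ≡ B ℤ.* (1ℤ ℤ.- ε ℤ.* A ℤ.* V) ℤ.+ ε ℤ.* V ℤ.* (A ℤ.* B ℤ.- δ)
  combination = solve-∀
  N∣b-w : + N ∣ + b ℤ.- w
  N∣b-w = subst (+ N ∣_) (sym (combination (+ a) (+ b) δ ε V))
            (∣m∣n⇒∣m+n (∣n⇒∣m*n (+ b) εaV≡1) (∣n⇒∣m*n (ε ℤ.* V) ab≡δ))
  ∣b-w∣<N : ∣ + b ℤ.- w ∣ < N
  ∣b-w∣<N = ℕP.≤-<-trans (ℤP.∣i-j∣≤∣i∣+∣j∣ (+ b) w)
              (subst (λ v → b ℕ.+ v < N) (sym (∣unit*i∣≡∣i∣ (unit-* ε-unit δ-unit) V)) b+∣V∣<N)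
    where
    b+∣V∣<N : b ℕ.+ ∣ V ∣ < N
    b+∣V∣<N = ℕP.*-cancelˡ-< 2 _ _ (begin-strict
      2 ℕ.* (b ℕ.+ ∣ V ∣)          ≡⟨ ℕP.*-distribˡ-+ 2 b ∣ V ∣ ⟩
      2 ℕ.* b ℕ.+ 2 ℕ.* ∣ V ∣      <⟨ ℕP.+-mono-<-≤ 2b<N 2∣V∣≤N ⟩
      N ℕ.+ N                    ≡⟨ cong (N ℕ.+_) (ℕP.+-identityʳ N) ⟨
      2 ℕ.* N                    ∎)
      where open ℕP.≤-Reasoning
  w≡b : w ≡ + b
  w≡b = sym (ℤP.i-j≡0⇒i≡j (+ b) w (∣-small⇒0 N∣b-w ∣b-w∣<N))

fold-det : ∀ {τ} → Unit τ → ∀ D r s U V →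
  r ℤ.* (τ ℤ.* (U ℤ.- D ℤ.* V)) ℤ.- s ℤ.* V ≡ ℤ.- (τ ℤ.* ((D ℤ.* r ℤ.+ τ ℤ.* s) ℤ.* V ℤ.- r ℤ.* U))
fold-det 1ᵘ  D r s U V = solve (D ∷ r ∷ s ∷ U ∷ V ∷ [])
fold-det -1ᵘ D r s U V = solve (D ∷ r ∷ s ∷ U ∷ V ∷ [])

fold-div : ∀ {τ} → Unit τ → ∀ D r s U V c →
  s ℤ.- c ℤ.* (τ ℤ.* (U ℤ.- D ℤ.* V)) ≡ τ ℤ.* ((D ℤ.* r ℤ.+ τ ℤ.* s ℤ.- c ℤ.* U) ℤ.- D ℤ.* (r ℤ.- c ℤ.* V))
fold-div 1ᵘ  D r s U V c = solve (D ∷ r ∷ s ∷ U ∷ V ∷ c ∷ [])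
fold-div -1ᵘ D r s U V c = solve (D ∷ r ∷ s ∷ U ∷ V ∷ c ∷ [])

fold-eq : ∀ {τ} → Unit τ → ∀ P D r s U V →
  P ℤ.* (D ℤ.* r ℤ.+ τ ℤ.* s) ℤ.+ U ≡ D ℤ.* (P ℤ.* r ℤ.+ V) ℤ.+ τ ℤ.* (P ℤ.* s ℤ.+ τ ℤ.* (U ℤ.- D ℤ.* V))
fold-eq 1ᵘ  P D r s U V = solve (P ∷ D ∷ r ∷ s ∷ U ∷ V ∷ [])
fold-eq -1ᵘ P D r s U V = solve (P ∷ D ∷ r ∷ s ∷ U ∷ V ∷ [])

module Lifting {N x : ℕ} (N≥1 : 1 ≤ N) (4≤x : 4 ≤ x) where

  P : ℕ
  P = x ℕ.* N

  lifted : ℕ → ℤ → ℤ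
  lifted q U = + P ℤ.* + q ℤ.+ U

  3N<P : 3 ℕ.* N < P
  3N<P = ℕP.<-≤-trans (ℕP.*-monoˡ-< N (ℕP.≤-refl {4})) (ℕP.*-monoˡ-≤ N 4≤x)
    where instance _ = ℕ.>-nonZero N≥1

  N<Pq : ∀ {q} → 1 ≤ q → N < P ℕ.* q
  N<Pq {q} q≥1 = begin-strict
    N              ≤⟨ ℕP.m≤m+n N _ ⟩
    3 ℕ.* N        <⟨ 3N<P ⟩
    P              ≡⟨ ℕP.*-identityʳ P ⟨
    P ℕ.* 1        ≤⟨ ℕP.*-monoʳ-≤ P q≥1 ⟩
    P ℕ.* q        ∎
    where open ℕP.≤-Reasoning

  lifted-nonneg : ∀ {q} U → 1 ≤ q → ∣ U ∣ ≤ N → 0ℤ ℤ.≤ lifted q U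
  lifted-nonneg {q} U q≥1 ∣U∣≤N = begin
    0ℤ                     ≤⟨ ℤP.i≤j⇒0≤j-i (ℤ.+≤+ (ℕP.<⇒≤ (N<Pq q≥1))) ⟩
    + (P ℕ.* q) ℤ.- + N    ≤⟨ ℤP.+-monoʳ-≤ (+ (P ℕ.* q)) (proj₁ (∣∣-bounds U ∣U∣≤N)) ⟩
    + (P ℕ.* q) ℤ.+ U      ≡⟨ cong (ℤ._+ U) (ℤP.pos-* P q) ⟩
    lifted q U             ∎
    where open ℤP.≤-Reasoning

  2[Ps+N]+N<Pr : ∀ {r s} → 2 ℕ.* s < r → 2 ℕ.* (P ℕ.* s ℕ.+ N) ℕ.+ N < P ℕ.* r
  2[Ps+N]+N<Pr {r} {s} 2s<r = begin-strict
    2 ℕ.* (P ℕ.* s ℕ.+ N) ℕ.+ N   ≡⟨ regroup P s N ⟩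
    P ℕ.* (2 ℕ.* s) ℕ.+ 3 ℕ.* N   <⟨ ℕP.+-monoʳ-< (P ℕ.* (2 ℕ.* s)) 3N<P ⟩
    P ℕ.* (2 ℕ.* s) ℕ.+ P         ≡⟨ trans (ℕP.+-comm _ P) (sym (ℕP.*-suc P (2 ℕ.* s))) ⟩
    P ℕ.* suc (2 ℕ.* s)          ≤⟨ ℕP.*-monoʳ-≤ P 2s<r ⟩
    P ℕ.* r                      ∎
    where
    open ℕP.≤-Reasoning
    regroup : ∀ P s N → 2 ℕ.* (P ℕ.* s ℕ.+ N) ℕ.+ N ≡ P ℕ.* (2 ℕ.* s) ℕ.+ 3 ℕ.* N
    regroup = ℕSolver.solve-∀

  lifted-rounding : ∀ {r s} V W → 2 ℕ.* s < r → ∣ V ∣ ≤ N → ∣ W ∣ ≤ N →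
                    + 2 ℤ.* lifted s W ℤ.< lifted r V
  lifted-rounding {r} {s} V W 2s<r ∣V∣≤N ∣W∣≤N = begin-strict
    + 2 ℤ.* lifted s W              ≤⟨ ℤP.*-monoˡ-≤-nonNeg (+ 2) (ℤP.+-monoʳ-≤ (+ P ℤ.* + s) (proj₂ (∣∣-bounds W ∣W∣≤N))) ⟩
    + 2 ℤ.* (+ P ℤ.* + s ℤ.+ + N)   ≡⟨ positive P s N ⟩
    + (2 ℕ.* (P ℕ.* s ℕ.+ N))       <⟨ a+n<b⇒a<b-n (2[Ps+N]+N<Pr 2s<r) ⟩
    + (P ℕ.* r) ℤ.- + N             ≤⟨ ℤP.+-monoʳ-≤ (+ (P ℕ.* r)) (proj₁ (∣∣-bounds V ∣V∣≤N)) ⟩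
    + (P ℕ.* r) ℤ.+ V               ≡⟨ cong (ℤ._+ V) (ℤP.pos-* P r) ⟩
    lifted r V                      ∎
    where
    open ℤP.≤-Reasoning
    positive : ∀ P s N → + 2 ℤ.* (+ P ℤ.* + s ℤ.+ + N) ≡ + (2 ℕ.* (P ℕ.* s ℕ.+ N))
    positive P s N = trans (cong (λ t → + 2 ℤ.* (t ℤ.+ + N)) (sym (ℤP.pos-* P s)))
                       (trans (cong (+ 2 ℤ.*_) (sym (ℤP.pos-+ (P ℕ.* s) N))) (sym (ℤP.pos-* 2 (P ℕ.* s ℕ.+ N))))

  module _ {b : ℕ} {c : ℤ} (x≤8 : x ≤ 8) (nicf-b : NICF N b) (2b<N : 2 ℕ.* b < N)
           (b-unique : ∀ V → + N ∣ 1ℤ ℤ.- c ℤ.* V → 2 ℕ.* ∣ V ∣ ≤ N → ∣ V ∣ ≡ b) where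

    fold-last : ∀ {D} U V → 2 < D → 2 ≤ D → D ≤ 8 → ∣ U ∣ ≤ ∣ V ∣ →
                ∣ + D ℤ.* V ℤ.- + 1 ℤ.* U ∣ ≡ N → + N ∣ 1ℤ ℤ.- c ℤ.* V →
                NICF ∣ lifted D U ∣ ∣ lifted 1 V ∣
    fold-last {D} U V 2<D 2≤D D≤8 ∣U∣≤∣V∣ det N∣1-cV =
      step-ℤ D (unit-neg κ-unit) (lifted-nonneg U (ℕP.<-trans (s≤s z≤n) 2<D) ∣U∣≤N) R≥0 (ℤ.+≤+ z≤n)
        Q≡ 2N<R 2≤D D≤8 nicf-R
      where
      2∣V∣≤N : 2 ℕ.* ∣ V ∣ ≤ N
      2∣V∣≤N = perturbation-bound 2 U V 2<D ∣U∣≤∣V∣ det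
      ∣V∣≤N : ∣ V ∣ ≤ N
      ∣V∣≤N = ℕP.≤-trans (ℕP.m≤m+n ∣ V ∣ _) 2∣V∣≤N
      ∣U∣≤N : ∣ U ∣ ≤ N
      ∣U∣≤N = ℕP.≤-trans ∣U∣≤∣V∣ ∣V∣≤N
      R≥0 : 0ℤ ℤ.≤ lifted 1 V
      R≥0 = lifted-nonneg V ℕP.≤-refl ∣V∣≤N
      det-sign : Σ ℤ λ κ → Unit κ × + D ℤ.* V ℤ.- + 1 ℤ.* U ≡ κ ℤ.* + N
      det-sign = ∣i∣≡n⇒i≡unit*n det
      κ : ℤ
      κ = proj₁ det-sign
      κ-unit : Unit κ
      κ-unit = proj₁ (proj₂ det-sign)
      V-sign : Σ ℤ λ λ′ → Unit λ′ × V ≡ λ′ ℤ.* + b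
      V-sign = ∣i∣≡n⇒i≡unit*n (b-unique V N∣1-cV 2∣V∣≤N)
      Q≡ : lifted D U ≡ + D ℤ.* lifted 1 V ℤ.+ ℤ.- κ ℤ.* + N
      Q≡ = begin
        + P ℤ.* + D ℤ.+ U                                              ≡⟨ unfold (+ P) (+ D) U V ⟩
        + D ℤ.* lifted 1 V ℤ.+ ℤ.- (+ D ℤ.* V ℤ.- + 1 ℤ.* U)           ≡⟨ cong (λ t → + D ℤ.* lifted 1 V ℤ.+ ℤ.- t) (proj₂ (proj₂ det-sign)) ⟩
        + D ℤ.* lifted 1 V ℤ.+ ℤ.- (κ ℤ.* + N)                         ≡⟨ cong (ℤ._+_ (+ D ℤ.* lifted 1 V)) (ℤP.neg-distribˡ-* κ (+ N)) ⟩
        + D ℤ.* lifted 1 V ℤ.+ ℤ.- κ ℤ.* + N                           ∎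
        where
        open ≡-Reasoning
        unfold : ∀ P D U V → P ℤ.* D ℤ.+ U ≡ D ℤ.* (P ℤ.* + 1 ℤ.+ V) ℤ.+ ℤ.- (D ℤ.* V ℤ.- + 1 ℤ.* U)
        unfold = solve-∀
      2N<R : + 2 ℤ.* + N ℤ.< lifted 1 V
      2N<R = subst (λ t → + 2 ℤ.* t ℤ.< lifted 1 V) (trans (cong (ℤ._+ + N) (ℤP.*-zeroʳ (+ P))) (ℤP.+-identityˡ (+ N)))
               (lifted-rounding {s = 0} V (+ N) (s≤s z≤n) ∣V∣≤N ℕP.≤-refl)
      R≡ : lifted 1 V ≡ + x ℤ.* + N ℤ.+ proj₁ V-sign ℤ.* + b
      R≡ = cong₂ ℤ._+_ (trans (ℤP.*-identityʳ (+ P)) (ℤP.pos-* x N)) (proj₂ (proj₂ V-sign))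
      nicf-R : NICF ∣ lifted 1 V ∣ N
      nicf-R = step-ℤ x (proj₁ (proj₂ V-sign)) R≥0 (ℤ.+≤+ z≤n) (ℤ.+≤+ z≤n) R≡
        (subst (ℤ._< + N) (ℤP.pos-* 2 b) (ℤ.+<+ 2b<N)) (ℕP.≤-trans ≤! 4≤x) x≤8 nicf-b

    -- With P = xN, a step q = Dr + τs of the expansion of a/N lifts to the step
    -- Pq + U = D(Pr + V) + τ(Ps + W), W = τ(U − DV), as long as the perturbations stay below N,
    -- which the invariant qV − rU = ±N guarantees. When the expansion of a/N is exhausted, V ≡ ±b,
    -- and the lifted expansion continues with x and then the expansion of b/N.
    fold : ∀ {q r} → NICF q r → 2 ℕ.* r < q → 1 ≤ r → ∀ U V → ∣ U ∣ ≤ ∣ V ∣ →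
           ∣ + q ℤ.* V ℤ.- + r ℤ.* U ∣ ≡ N → + N ∣ + q ℤ.- c ℤ.* U → + N ∣ + r ℤ.- c ℤ.* V →
           NICF ∣ lifted q U ∣ ∣ lifted r V ∣
    fold end _ ()
    fold {q} (step {τ = τ} D τ-unit q≡ _ 2≤D D≤8 end) 2<q _ U V ∣U∣≤∣V∣ det _ N∣1-cV
      with ℤP.+-injective (trans q≡ (D*1+τ*0≡D D τ))
    ... | refl = fold-last U V 2<q 2≤D D≤8 ∣U∣≤∣V∣ det N∣1-cV
    fold {q} {r} (step {s = s} {τ} D τ-unit q≡ 2s<r 2≤D D≤8 tail@(step _ _ _ 2t<s _ _ _))
         2r<q r≥1 U V ∣U∣≤∣V∣ det N∣q-cU N∣r-cV =
      step-ℤ D τ-unit (lifted-nonneg U q≥1 ∣U∣≤N) (lifted-nonneg V r≥1 ∣V∣≤N) (lifted-nonneg W s≥1 ∣W∣≤N)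
        lifted-q≡ (lifted-rounding V W 2s<r ∣V∣≤N ∣W∣≤N) 2≤D D≤8
        (fold tail 2s<r s≥1 V W ∣V∣≤∣W∣ det′ N∣r-cV N∣s-cW)
      where
      W : ℤ
      W = τ ℤ.* (U ℤ.- + D ℤ.* V)
      Q : ℤ
      Q = + D ℤ.* + r ℤ.+ τ ℤ.* + s
      r<q : r < q
      r<q = ℕP.≤-<-trans (ℕP.m≤m+n r _) 2r<q
      s<r : s < r
      s<r = ℕP.≤-<-trans (ℕP.m≤m+n s _) 2s<r
      q≥1 : 1 ≤ q
      q≥1 = ℕP.≤-trans r≥1 (ℕP.<⇒≤ r<q)
      s≥1 : 1 ≤ s
      s≥1 = ℕP.≤-trans (s≤s z≤n) 2t<s
      ∣V∣≤N : ∣ V ∣ ≤ N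
      ∣V∣≤N = subst (_≤ N) (ℕP.*-identityˡ ∣ V ∣) (perturbation-bound 1 U V r<q ∣U∣≤∣V∣ det)
      ∣U∣≤N : ∣ U ∣ ≤ N
      ∣U∣≤N = ℕP.≤-trans ∣U∣≤∣V∣ ∣V∣≤N
      ∣V∣≤∣W∣ : ∣ V ∣ ≤ ∣ W ∣
      ∣V∣≤∣W∣ = subst (∣ V ∣ ≤_) (sym (∣unit*i∣≡∣i∣ τ-unit _)) (∣V∣≤∣U-DV∣ U V D ∣U∣≤∣V∣ 2≤D)
      det′ : ∣ + r ℤ.* W ℤ.- + s ℤ.* V ∣ ≡ N
      det′ = begin
        ∣ + r ℤ.* W ℤ.- + s ℤ.* V ∣                   ≡⟨ cong ∣_∣ (fold-det τ-unit (+ D) (+ r) (+ s) U V) ⟩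
        ∣ ℤ.- (τ ℤ.* (Q ℤ.* V ℤ.- + r ℤ.* U)) ∣         ≡⟨ ℤP.∣-i∣≡∣i∣ (τ ℤ.* (Q ℤ.* V ℤ.- + r ℤ.* U)) ⟩
        ∣ τ ℤ.* (Q ℤ.* V ℤ.- + r ℤ.* U) ∣              ≡⟨ ∣unit*i∣≡∣i∣ τ-unit _ ⟩
        ∣ Q ℤ.* V ℤ.- + r ℤ.* U ∣                     ≡⟨ cong (λ q → ∣ q ℤ.* V ℤ.- + r ℤ.* U ∣) q≡ ⟨
        ∣ + q ℤ.* V ℤ.- + r ℤ.* U ∣                   ≡⟨ det ⟩
        N                                            ∎
        where open ≡-Reasoning
      ∣W∣≤N : ∣ W ∣ ≤ N
      ∣W∣≤N = subst (_≤ N) (ℕP.*-identityˡ ∣ W ∣) (perturbation-bound 1 V W s<r ∣V∣≤∣W∣ det′)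
      N∣s-cW : + N ∣ + s ℤ.- c ℤ.* W
      N∣s-cW = subst (+ N ∣_) (sym (fold-div τ-unit (+ D) (+ r) (+ s) U V c))
        (∣n⇒∣m*n τ (∣m∣n⇒∣m-n (subst (λ q → + N ∣ q ℤ.- c ℤ.* U) q≡ N∣q-cU) (∣n⇒∣m*n (+ D) N∣r-cV)))
      lifted-q≡ : lifted q U ≡ + D ℤ.* lifted r V ℤ.+ τ ℤ.* lifted s W
      lifted-q≡ = trans (cong (λ q → + P ℤ.* q ℤ.+ U) q≡) (fold-eq τ-unit (+ P) (+ D) (+ r) (+ s) U V)

  PN≡ : ∣ lifted N 0ℤ ∣ ≡ x ℕ.* N ℕ.* N
  PN≡ = cong ∣_∣ (trans (ℤP.+-identityʳ _) (sym (ℤP.pos-* P N)))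

  folding : ∀ {a b δ ε} → x ≤ 8 → Unit δ → Unit ε → NICF N a → NICF N b → 2 ℕ.* a < N → 2 ℕ.* b < N →
            1 ≤ a → + N ∣ + a ℤ.* + b ℤ.- δ → NICF (x ℕ.* N ℕ.* N) ∣ lifted a ε ∣
  folding {a} {b} {δ} {ε} x≤8 δ-unit ε-unit nicf-a nicf-b 2a<N 2b<N a≥1 ab≡δ =
    subst (λ n → NICF n ∣ lifted a ε ∣) PN≡
      (fold {c = ε ℤ.* + a} x≤8 nicf-b 2b<N (inverse-unique {a = a} δ-unit ε-unit ab≡δ 2b<N)
        nicf-a 2a<N a≥1 0ℤ ε z≤n det N∣N a∣a)
    where
    start-det : ∀ N ε a → N ℤ.* ε ℤ.- a ℤ.* 0ℤ ≡ ε ℤ.* N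
    start-det = solve-∀
    det : ∣ + N ℤ.* ε ℤ.- + a ℤ.* 0ℤ ∣ ≡ N
    det = trans (cong ∣_∣ (start-det (+ N) ε (+ a))) (∣unit*i∣≡∣i∣ ε-unit (+ N))
    start-N : ∀ N ε a → N ≡ N ℤ.- ε ℤ.* a ℤ.* 0ℤ
    start-N = solve-∀
    N∣N : + N ∣ + N ℤ.- ε ℤ.* + a ℤ.* 0ℤ
    N∣N = subst (+ N ∣_) (start-N (+ N) ε (+ a)) ∣-refl
    a∣a : + N ∣ + a ℤ.- ε ℤ.* + a ℤ.* ε
    a∣a = subst (+ N ∣_) (sym (unit-conjugate ε-unit (+ a))) (divides 0ℤ refl)

  2∣lifted∣<PN : ∀ {a ε} → Unit ε → 2 ℕ.* a < N → 2 ℕ.* ∣ lifted a ε ∣ < x ℕ.* N ℕ.* N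
  2∣lifted∣<PN {a} {ε} ε-unit 2a<N = begin-strict
    2 ℕ.* ∣ lifted a ε ∣            ≤⟨ ℕP.*-monoʳ-≤ 2 ∣lifted∣≤Pa+1 ⟩
    2 ℕ.* (P ℕ.* a ℕ.+ 1)           ≡⟨ regroup P a ⟩
    P ℕ.* (2 ℕ.* a) ℕ.+ 2           <⟨ ℕP.+-monoʳ-< (P ℕ.* (2 ℕ.* a)) 2<P ⟩
    P ℕ.* (2 ℕ.* a) ℕ.+ P           ≡⟨ trans (ℕP.+-comm _ P) (sym (ℕP.*-suc P (2 ℕ.* a))) ⟩
    P ℕ.* suc (2 ℕ.* a)             ≤⟨ ℕP.*-monoʳ-≤ P 2a<N ⟩
    P ℕ.* N                         ∎
    where
    open ℕP.≤-Reasoning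
    regroup : ∀ P a → 2 ℕ.* (P ℕ.* a ℕ.+ 1) ≡ P ℕ.* (2 ℕ.* a) ℕ.+ 2
    regroup = ℕSolver.solve-∀
    2<P : 2 < P
    2<P = ℕP.<-≤-trans ≤! (ℕP.≤-trans 4≤x (ℕP.m≤m*n x N))
      where instance _ = ℕ.>-nonZero N≥1
    ∣lifted∣≤Pa+1 : ∣ lifted a ε ∣ ≤ P ℕ.* a ℕ.+ 1
    ∣lifted∣≤Pa+1 = ℕP.≤-trans (ℤP.∣i+j∣≤∣i∣+∣j∣ (+ P ℤ.* + a) ε)
      (ℕP.≤-reflexive (cong₂ ℕ._+_ (ℤP.∣i*j∣≡∣i∣*∣j∣ (+ P) (+ a)) (∣unit∣≡1 ε-unit)))

  lifted-inverse : ∀ {a} → 1 ≤ a → + (x ℕ.* N ℕ.* N) ∣ + ∣ lifted a 1ℤ ∣ ℤ.* + ∣ lifted a -1ℤ ∣ ℤ.- -1ℤ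
  lifted-inverse {a} a≥1 = divides (+ x ℤ.* + a ℤ.* + a) (begin
    + ∣ lifted a 1ℤ ∣ ℤ.* + ∣ lifted a -1ℤ ∣ ℤ.- -1ℤ                         ≡⟨ cong₂ (λ u v → u ℤ.* v ℤ.- -1ℤ) (+∣lifted∣ 1ᵘ) (+∣lifted∣ -1ᵘ) ⟩
    (+ x ℤ.* + N ℤ.* + a ℤ.+ 1ℤ) ℤ.* (+ x ℤ.* + N ℤ.* + a ℤ.+ -1ℤ) ℤ.- -1ℤ   ≡⟨ difference-of-squares (+ x) (+ N) (+ a) ⟩
    (+ x ℤ.* + a ℤ.* + a) ℤ.* (+ x ℤ.* + N ℤ.* + N)                        ≡⟨ cong (ℤ._*_ (+ x ℤ.* + a ℤ.* + a)) xNN≡ ⟩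
    (+ x ℤ.* + a ℤ.* + a) ℤ.* + (x ℕ.* N ℕ.* N)                            ∎)
    where
    open ≡-Reasoning
    +∣lifted∣ : ∀ {ε} → Unit ε → + ∣ lifted a ε ∣ ≡ + x ℤ.* + N ℤ.* + a ℤ.+ ε
    +∣lifted∣ ε-unit = trans (ℤP.0≤i⇒+∣i∣≡i (lifted-nonneg _ a≥1 (ℕP.≤-trans (ℕP.≤-reflexive (∣unit∣≡1 ε-unit)) N≥1)))
                             (cong (λ p → p ℤ.* + a ℤ.+ _) (ℤP.pos-* x N))
    difference-of-squares : ∀ x N a → (x ℤ.* N ℤ.* a ℤ.+ 1ℤ) ℤ.* (x ℤ.* N ℤ.* a ℤ.+ -1ℤ) ℤ.- -1ℤ
                                      ≡ (x ℤ.* a ℤ.* a) ℤ.* (x ℤ.* N ℤ.* N)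
    difference-of-squares = solve-∀
    xNN≡ : + x ℤ.* + N ℤ.* + N ≡ + (x ℕ.* N ℕ.* N)
    xNN≡ = trans (cong (ℤ._* + N) (sym (ℤP.pos-* x N))) (sym (ℤP.pos-* (x ℕ.* N) N))

  lifted-odd : ∀ {a} → 2 ℕᵈ.∣ x → ∣ lifted a 1ℤ ∣ % 2 ≡ 1
  lifted-odd {a} 2∣x = trans (cong (λ n → ∣ n ℤ.+ 1ℤ ∣ % 2) (sym (ℤP.pos-* P a)))
                             (even+1-odd (ℕᵈ.∣m⇒∣m*n a (ℕᵈ.∣m⇒∣m*n N 2∣x)))

record ZarembaPair (N : ℕ) : Set where
  field
    a b    : ℕ
    nicf-a : NICF N a
    nicf-b : NICF N b
    2a<N   : 2 ℕ.* a < N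
    2b<N   : 2 ℕ.* b < N
    {δ}    : ℤ
    δ-unit : Unit δ
    ab≡δ   : + N ∣ + a ℤ.* + b ℤ.- δ
    a-odd  : a % 2 ≡ 1

fold-pair : ∀ {N x} → ZarembaPair N → 4 ≤ x → x ≤ 8 → 2 ℕᵈ.∣ x → ZarembaPair (x ℕ.* N ℕ.* N)
fold-pair {N} {x} pair 4≤x x≤8 2∣x = record
  { a      = ∣ lifted a 1ℤ ∣
  ; b      = ∣ lifted a -1ℤ ∣
  ; nicf-a = fold-with 1ᵘ
  ; nicf-b = fold-with -1ᵘ
  ; 2a<N   = 2∣lifted∣<PN 1ᵘ 2a<N
  ; 2b<N   = 2∣lifted∣<PN -1ᵘ 2a<N
  ; δ-unit = -1ᵘ
  ; ab≡δ   = lifted-inverse a≥1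
  ; a-odd  = lifted-odd 2∣x
  }
  where
  open ZarembaPair pair
  a≥1 : 1 ≤ a
  a≥1 = odd⇒positive a-odd
  open Lifting (ℕP.≤-trans (s≤s z≤n) 2a<N) 4≤x
  fold-with : ∀ {ε} → Unit ε → NICF (x ℕ.* N ℕ.* N) ∣ lifted a ε ∣
  fold-with ε-unit = folding x≤8 δ-unit ε-unit nicf-a nicf-b 2a<N 2b<N a≥1 ab≡δ

-- Powers of two

nicf-3-1 : NICF 3 1
nicf-3-1 = step 3 1ᵘ refl ≤! ≤! ≤! end

nicf-4-1 : NICF 4 1
nicf-4-1 = step 4 1ᵘ refl ≤! ≤! ≤! end

nicf-5-1 : NICF 5 1
nicf-5-1 = step 5 1ᵘ refl ≤! ≤! ≤! end

zaremba-4 : ZarembaPair 4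
zaremba-4 = record
  { a = 1 ; b = 1 ; nicf-a = nicf-4-1 ; nicf-b = nicf-4-1 ; 2a<N = ≤! ; 2b<N = ≤!
  ; δ-unit = 1ᵘ ; ab≡δ = divides 0ℤ refl ; a-odd = refl }

zaremba-8 : ZarembaPair 8
zaremba-8 = record
  { a = 3 ; b = 3 ; nicf-a = nicf-8-3 ; nicf-b = nicf-8-3 ; 2a<N = ≤! ; 2b<N = ≤!
  ; δ-unit = 1ᵘ ; ab≡δ = divides 1ℤ refl ; a-odd = refl }
  where
  nicf-8-3 : NICF 8 3
  nicf-8-3 = step 3 -1ᵘ refl ≤! ≤! ≤! nicf-3-1

zaremba-16 : ZarembaPair 16
zaremba-16 = record
  { a = 5 ; b = 3
  ; nicf-a = step 3 1ᵘ refl ≤! ≤! ≤! nicf-5-1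
  ; nicf-b = step 5 1ᵘ refl ≤! ≤! ≤! nicf-3-1
  ; 2a<N = ≤! ; 2b<N = ≤! ; δ-unit = -1ᵘ ; ab≡δ = divides 1ℤ refl ; a-odd = refl }

zaremba-32 : ZarembaPair 32
zaremba-32 = record
  { a = 7 ; b = 9
  ; nicf-a = step 5 -1ᵘ refl ≤! ≤! ≤! (step 2 1ᵘ refl ≤! ≤! ≤! nicf-3-1)
  ; nicf-b = step 4 -1ᵘ refl ≤! ≤! ≤! (step 2 1ᵘ refl ≤! ≤! ≤! nicf-4-1)
  ; 2a<N = ≤! ; 2b<N = ≤! ; δ-unit = -1ᵘ ; ab≡δ = divides (+ 2) refl ; a-odd = refl }

zaremba-pow : ∀ e → ZarembaPair (2 ^ (2 ℕ.+ e))
zaremba-pow = <-rec (λ e → ZarembaPair (2 ^ (2 ℕ.+ e))) go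
  where
  go : ∀ e → (∀ {e′} → e′ < e → ZarembaPair (2 ^ (2 ℕ.+ e′))) → ZarembaPair (2 ^ (2 ℕ.+ e))
  go 0 _ = zaremba-4
  go 1 _ = zaremba-8
  go 2 _ = zaremba-16
  go 3 _ = zaremba-32
  go (suc (suc (suc (suc k)))) rec =
    subst ZarembaPair (sym power-split) (fold-pair (rec h<4+k) 4≤x x≤8 (ℕᵈ.m∣m*n (2 ^ suc r)))
    where
    r : ℕ
    r = k % 2
    h : ℕ
    h = k div 2
    h<4+k : h < 4 ℕ.+ k
    h<4+k = s≤s (ℕP.≤-trans (m/n≤m k 2) (ℕP.m≤n+m k 3))
    4≤x : 4 ≤ 2 ^ (2 ℕ.+ r)
    4≤x = ℕP.^-monoʳ-≤ 2 (ℕP.m≤m+n 2 r)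
    x≤8 : 2 ^ (2 ℕ.+ r) ≤ 8
    x≤8 = ℕP.^-monoʳ-≤ 2 (ℕP.+-monoʳ-≤ 2 (ℕ.s≤s⁻¹ (m%n<n k 2)))
    exponent : ∀ r h → 2 ℕ.+ (4 ℕ.+ (r ℕ.+ h ℕ.* 2)) ≡ (2 ℕ.+ r) ℕ.+ (2 ℕ.+ h) ℕ.+ (2 ℕ.+ h)
    exponent = ℕSolver.solve-∀
    power-split : 2 ^ (2 ℕ.+ (4 ℕ.+ k)) ≡ 2 ^ (2 ℕ.+ r) ℕ.* 2 ^ (2 ℕ.+ h) ℕ.* 2 ^ (2 ℕ.+ h)
    power-split = begin
      2 ^ (2 ℕ.+ (4 ℕ.+ k))                             ≡⟨ cong (λ k → 2 ^ (2 ℕ.+ (4 ℕ.+ k))) (m≡m%n+[m/n]*n k 2) ⟩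
      2 ^ (2 ℕ.+ (4 ℕ.+ (r ℕ.+ h ℕ.* 2)))               ≡⟨ cong (2 ^_) (exponent r h) ⟩
      2 ^ ((2 ℕ.+ r) ℕ.+ (2 ℕ.+ h) ℕ.+ (2 ℕ.+ h))        ≡⟨ ℕP.^-distribˡ-+-* 2 ((2 ℕ.+ r) ℕ.+ (2 ℕ.+ h)) (2 ℕ.+ h) ⟩
      2 ^ ((2 ℕ.+ r) ℕ.+ (2 ℕ.+ h)) ℕ.* 2 ^ (2 ℕ.+ h)   ≡⟨ cong (ℕ._* 2 ^ (2 ℕ.+ h)) (ℕP.^-distribˡ-+-* 2 (2 ℕ.+ r) (2 ℕ.+ h)) ⟩
      2 ^ (2 ℕ.+ r) ℕ.* 2 ^ (2 ℕ.+ h) ℕ.* 2 ^ (2 ℕ.+ h) ∎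
      where open ≡-Reasoning

theorem5p3 : (k : ℕ) → 1 ≤ k →
    Σ ℕ (λ a → (a % 2 ≡ 1) × (1 ≤ a) × (a < 2 ^ k) ×
      Σ ℕ (λ fuel → Σ (List ℤ[i]) (λ ds →
        (hurwitzDigits fuel (realℚ (_/_ (+ a) (2 ^ k) {{m^n≢0 2 k}})) ≡ just ds)
        × All (λ d → normℤ[i] d ≤ℤ + 64) ds)))
theorem5p3 zero ()
-- [1/2] = 1 and 1/(1/2 − 1) = −2.
theorem5p3 (suc zero) _ = 1 , refl , ≤! , ≤! , 1 , (-[1+ 1 ] , 0ℤ) ∷ [] , refl , ℤP.≤ᵇ⇒≤ _ All.∷ All.[]
theorem5p3 (suc (suc e)) _ =
  a , a-odd , odd⇒positive a-odd , ℕP.≤-<-trans (ℕP.m≤m+n a _) 2a<N ,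
  fraction-smallDigits {{m^n≢0 2 (2 ℕ.+ e)}} nicf-a 2a<N
  where open ZarembaPair (zaremba-pow e)
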